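{- Let $\mathcal M_1,\dots,\mathcal M_n$ be compatible ITSs, $\mathcal C=\mathcal M_1\otimes\dots\otimes\mathcal M_n$, and fix $i$. Every syntactically stutter-tolerant formula $\varphi$ over $V_i$ is stutter-tolerant with respect to $\mathcal R^{sgn}$, for each $sgn\in\{ -,+\}$; that is: for every trace $\pi$ of $\mathcal M_i$, every $\pi^{ST}\in Pr_i^{ -1}(\pi)$, every $0\le k<|\pi|$ and every $j$ with $map_{k-1}<j<map_k$: $\pi^{ST},j\models_{t^{sgn}}\mathcal R^{sgn}(\varphi)$ if and only if $\pi^{ST},map_k\models_{t^{sgn}}\mathcal R^{sgn}(\varphi)$ (satisfaction with the input/output partition of $\mathcal C$).
   Context: Logic. Fix a first-order signature $\Sigma$ and a $\Sigma$-structure interpreting its symbols; $c^M,f^M,p^M$ denote interpretations. Given disjoint sets of input variables $V^I$ and output variables $V^O$, a trace over $(V^I,V^O)$ is a nonempty finite or infinite sequence $\pi=s_0s_1\cdots$ of assignments to $V^I\cup V^O$, except that if $\pi$ is finite its last assignment is defined only on $V^O$; $|\pi|$ is its length; $s|_U$ is restriction to $U$. Formulas: $\varphi::=\top\mid\bot\mid p(u_1,\dots,u_n)\mid\neg\varphi\mid\varphi\vee\varphi\mid X\varphi\mid\varphi U\varphi\mid Y\varphi\mid\varphi S\varphi$; terms: $u::=c\mid x\mid f(u_1,\dots,u_n)\mid next(u)\mid ite(\varphi,u,u)\mid u@\tilde F\varphi\mid u@\tilde P\varphi$ ($c,f,p$ symbols of $\Sigma$, $x$ a variable; Boolean variables are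 used as atomic formulas). Abbreviations: $\wedge,\to,\leftrightarrow$ as usual, $\varphi R\psi:=\neg(\neg\varphi U\neg\psi)$, $F\varphi:=\top U\varphi$, $G\varphi:=\neg F\neg\varphi$, $Z\varphi:=\neg Y\neg\varphi$, $v':=next(v)$. An atomic formula is an input predicate ($Pred^I$) if one of its arguments contains an input variable or a subterm $next(\cdot)$ or $\cdot@\tilde F\cdot$, and an output predicate ($Pred^O$) otherwise ($\top,\bot$ are output predicates, true and false). Truncated semantics, $sgn\in\{ -,+\}$, any position $i\in\mathbb N$: • output predicate: $\pi,i\models_{t^- }p(\bar u)$ iff $i\ge|\pi|$ or $p^M(\pi(i)(u_1),\dots,\pi(i)(u_n))$; $\pi,i\models_{t^+}p(\bar u)$ iff $i<|\pi|$ and $p^M(\dots)$; • input predicate: $\pi,i\models_{t^- }p(\bar u)$ iff $i\ge|\pi|-1$ or $p^M(\dots)$; $\pi,i\models_{t^+}p(\bar u)$ iff $i<|\pi|-1$ and $p^M(\dots)$; • $\vee$: either disjunct with the same $sgn$; $\pi,i\models_{t^- }\neg\varphi$ iff not $\pi,i\models_{t^+}\varphi$; $\pi,i\models_{t^+}\neg\varphi$ iff not $\pi,i\models_{t^- }\varphi$; • $\pi,i\models_{t^{sgn}}X\varphi$ iff $\pi,i+1\models_{t^{sgn}}\varphi$; • $\pi,i\models_{t^{sgn}}\varphi_1U\varphi_2$ iff some $k\ge i$ has $\pi,k\models_{t^{sgn}}\varphi_2$ and $\pi,l\models_{t^{sgn}}\varphi_1$ for all $i\le l<k$; • $\pi,i\models_{t^-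 }Y\varphi$ iff $i\ge|\pi|$ or ($i>0$ and $\pi,i-1\models_{t^- }\varphi$); $\pi,i\models_{t^+}Y\varphi$ iff $0<i<|\pi|$ and $\pi,i-1\models_{t^+}\varphi$; • $\pi,i\models_{t^- }\varphi_1S\varphi_2$ iff $i\ge|\pi|$ or some $k\le i$ has $\pi,k\models_{t^- }\varphi_2$ and $\pi,l\models_{t^- }\varphi_1$ for all $k<l\le i$; $\pi,i\models_{t^+}\varphi_1S\varphi_2$ iff $i<|\pi|$ and some $k\le i$ has $\pi,k\models_{t^+}\varphi_2$ and $\pi,l\models_{t^+}\varphi_1$ for all $k<l\le i$. Terms at $i<|\pi|$: $\pi(i)(c)=c^M$, $\pi(i)(x)=s_i(x)$, $\pi(i)(f(\bar u))=f^M(\pi(i)(u_1),\dots)$; $\pi(i)(next(u))=\pi(i+1)(u)$ if $|\pi|>i+1$, else $def_{next(u)}$; $\pi(i)(u@\tilde F\varphi)=\pi(k)(u)$ if some $k>i$ has $\pi,k\models_{t^+}\varphi$ and $\pi,l\models_{t^+}\neg\varphi$ for all $i<l<k$, else $def_{u@\tilde F\varphi}$; $\pi(i)(u@\tilde P\varphi)=\pi(k)(u)$ if some $k<i$ has $\pi,k\models_{t^+}\varphi$ and $\pi,l\models_{t^+}\neg\varphi$ for all $k<l<i$, else $def_{u@\tilde P\varphi}$; $\pi(i)(ite(\varphi,u_1,u_2))$ is $\pi(i)(u_1)$ if $\pi,i\models_{t^+}\varphi$, $\pi(i)(u_2)$ if $\pi,i\models_{t^+}\neg\varphi$, else $def_{ite(\varphi,u_1,u_2)}$;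 each $def_{\dots}$ is an extra symbol with a fixed default value. ITS. An ITS $\mathcal M=\langle V^I,V^O,\mathcal I,\mathcal T,\mathcal{SF}\rangle$ has disjoint inputs $V^I$ and outputs $V^O$ ($V=V^I\cup V^O$), initial condition $\mathcal I$ over $V^O$, transition condition $\mathcal T$ over $V\cup\{v':v\in V^O\}$, and strong fairness pairs $\langle f_A,f_G\rangle$ over $V$. A trace of $\mathcal M$ is a trace $\pi$ over $(V^I,V^O)$ with $s_0\models\mathcal I$, $s_k\cup s'_{k+1}\models\mathcal T$ for all $k<|\pi|-1$, and, if $\pi$ is infinite, for each fairness pair: $f_A$ infinitely often implies $f_G$ infinitely often. $\mathcal M_1,\dots,\mathcal M_n$ are compatible if $V_i\cap V_j=(V^O_i\cap V^I_j)\cup(V^I_i\cap V^O_j)$ for $i\ne j$. Composition with fresh Booleans $run_j,end_j$: $\mathcal M_1\otimes\dots\otimes\mathcal M_n=\langle V^I,V^O,\bigwedge_j\mathcal I_j,\mathcal T,\mathcal{SF}\rangle$, $W:=\bigcup_{j<k}(V_j\cap V_k)$, $V^I=(\bigcup_j(V^I_j\cup\{run_j\}))\setminus W$, $V^O=\bigcup_j(V^O_j\cup\{end_j\})\cup W$, $\mathcal T=\bigwedge_j((run_j\to\mathcal T_j)\wedge(\neg run_j\to\bigwedge_{v\in V^O_j}v=v')\wedge(end_j\leftrightarrow(end_j'\wedge\neg run_j)))$, $\mathcal{SF}=\bigcup_j(\{\langle\top,run_j\vee end_j\rangle\}\cup\{\langle run_j\wedge f_A,run_j\wedge f_G\rangle:\langle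 f_A,f_G\rangle\in\mathcal{SF}_j\})$. Projection. For a trace $\pi'=s_0s_1\cdots$ of $\mathcal C$ let $r_0<r_1<\cdots$ enumerate the positions where $run_i$ is true. If infinitely many: $Pr_i(\pi'):=s_{r_0}|_{V_i}s_{r_1}|_{V_i}\cdots$ and $map_k:=r_k$ for all $k\ge0$. Otherwise, with $N\ge0$ such positions, $m:=r_{N-1}+1$ ($m:=0$ if $N=0$), $Pr_i(\pi'):=s_{r_0}|_{V_i}\cdots s_{r_{N-1}}|_{V_i}s_m|_{V^O_i}$, $map_k:=r_k$ for $k<N$ and $map_N:=m$. Always $map_{ -1}:=-1$. For a trace $\pi$ of $\mathcal M_i$, $Pr_i^{ -1}(\pi)$ is the set of traces $\pi'$ of $\mathcal C$ with $Pr_i(\pi')=\pi$; $map_k$ refers to the sequence of the trace of $\mathcal C$ under consideration. Rewriting $\mathcal R$ (for component $i$; write $run:=run_i$, $end:=end_i$, $state:=run\vee(Z\,run\wedge end)$; input/output predicates below are relative to $\mathcal M_i$): $\mathcal R^-(Pred^I(u_1,\dots,u_n)):=\neg run\vee Pred^I(\mathcal R^-(u_1),\dots,\mathcal R^-(u_n))$; $\mathcal R^+(Pred^I(\bar u)):=run\wedge Pred^I(\mathcal R^+(u_1),\dots)$; $\mathcal R^{sgn}(Pred^O(\bar u)):=Pred^O(\mathcal R^{sgn}(u_1),\dots)$; $\mathcal R^{sgn}(\varphi_1\vee\varphi_2):=\mathcal R^{sgn}(\varphi_1)\vee\mathcal R^{sgn}(\varphi_2)$; $\mathcal R^-(\neg\varphi):=\neg\mathcal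 R^+(\varphi)$, $\mathcal R^+(\neg\varphi):=\neg\mathcal R^-(\varphi)$; $\mathcal R^-(X\varphi):=X(state\,R\,(\neg state\vee\mathcal R^-(\varphi)))$; $\mathcal R^+(X\varphi):=X(\neg state\,U\,(state\wedge\mathcal R^+(\varphi)))$; $\mathcal R^-(\varphi_1U\varphi_2):=(\neg state\vee\mathcal R^-(\varphi_1))\,U\,((state\wedge\mathcal R^-(\varphi_2))\vee Y\,end)$; $\mathcal R^+(\varphi_1U\varphi_2):=(\neg state\vee\mathcal R^+(\varphi_1))\,U\,(state\wedge\mathcal R^+(\varphi_2))$; $\mathcal R^{sgn}(Y\varphi):=Y(\neg run\,S\,(run\wedge\mathcal R^{sgn}(\varphi)))$; $\mathcal R^{sgn}(\varphi_1S\varphi_2):=(\neg state\vee\mathcal R^{sgn}(\varphi_1))\,S\,(state\wedge\mathcal R^{sgn}(\varphi_2))$; terms: $\mathcal R^{sgn}(x):=x$, $\mathcal R^{sgn}(c):=c$, $\mathcal R^{sgn}(f(\bar u)):=f(\mathcal R^{sgn}(u_1),\dots)$, $\mathcal R^{sgn}(ite(\varphi,u_1,u_2)):=ite(\mathcal R^+(\varphi),\mathcal R^-(u_1),ite(\mathcal R^+(\neg\varphi),\mathcal R^-(u_2),def_{ite(\varphi,u_1,u_2)}))$, $\mathcal R^{sgn}(next(u)):=\mathcal R^{sgn}(u)@\tilde F(state)$, $\mathcal R^{sgn}(u@\tilde F\varphi):=\mathcal R^{sgn}(u)@\tilde F(state\wedge\mathcal R^+(\varphi))$, $\mathcal R^{sgn}(u@\tilde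 P\varphi):=\mathcal R^{sgn}(u)@\tilde P(state\wedge\mathcal R^+(\varphi))$. Syntactically stutter-tolerant formulas $\varphi_{st}$ and terms $u_{st}$ (relative to $\mathcal M_i$) are given by: $\varphi_{st}::=\varphi_{st}\vee\varphi_{st}\mid\neg\varphi_{st}\mid Pred^O(u_{st},\dots,u_{st})\mid\varphi\,U\,\varphi\mid Y\varphi$ and $u_{st}::=f(u_{st},\dots,u_{st})\mid s\mid c\mid ite(\varphi_{st},u_{st},u_{st})\mid u@\tilde P\varphi$, where $\varphi$ is an arbitrary formula, $u$ an arbitrary term, $s$ an output variable of $\mathcal M_i$, $c$ a constant, and $Pred^O$ an output predicate. -}

module Defs where

open import Data.Nat using (ℕ; zero; suc; _<_; _≤_; _+_; _<ᵇ_)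
open import Data.Bool using (Bool; true; false; _∨_; _∧_; not; if_then_else_; T)
open import Data.Fin using (Fin; toℕ) renaming (zero to fzero; suc to fsuc)
open import Data.Maybe using (Maybe; just; nothing)
open import Data.Product using (Σ; _×_; _,_)
open import Data.Sum using (_⊎_)
open import Data.Unit using (⊤)
open import Data.Empty using (⊥)
open import Data.List using (List; allFin)
open import Data.Bool.ListAction using (any)
open import Data.List.Membership.Propositional using (_∈_)
open import Relation.Nullary using (¬_)
open import Relation.Binary.PropositionalEquality using (_≡_)

_⇔_ : Set → Set → Set
A ⇔ B = (A → B) × (B → A)

anyFin : ∀ {n} → (Fin n → Bool) → Bool
anyFin {zero}  f = false
anyFin {suc n} f = f fzero ∨ anyFin (λ a → f (fsuc a))

-- Lengths of traces: just n = finite of length n, nothing = infinite (ω)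
Len : Set
Len = Maybe ℕ

_<L_ : ℕ → Len → Set
i <L nothing = ⊤
i <L just n  = i < n

_<ᵇL_ : ℕ → Len → Bool
i <ᵇL nothing = true
i <ᵇL just n  = i <ᵇ n

record Signature : Set₁ where
  field
    Const Fun Pred : Set
    funAr  : Fun → ℕ
    predAr : Pred → ℕ

record Structure (S : Signature) : Set₁ where
  open Signature S
  field
    D      : Set
    constM : Const → D
    funM   : (f : Fun) → (Fin (funAr f) → D) → D
    predM  : (p : Pred) → (Fin (predAr p) → D) → Set
    -- truth value of a (Boolean) variable used as an atomic formula
    bool   : D → Bool

data Sgn : Set where
  minus plus : Sgn

module Syntax (S : Signature) where
  open Signature S

  infixr 5 _∨f_ _Uf_ _Sf_

  mutual
    data Fm (X : Set) : Set where
      ⊤f ⊥f : Fm X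
      pr    : (p : Pred) → (Fin (predAr p) → Tm X) → Fm X
      bv    : X → Fm X
      ¬f_   : Fm X → Fm X
      _∨f_  : Fm X → Fm X → Fm X
      Xf Yf : Fm X → Fm X
      _Uf_ _Sf_ : Fm X → Fm X → Fm X

    data Tm (X : Set) : Set where
      cst  : Const → Tm X
      var  : X → Tm X
      fn   : (f : Fun) → (Fin (funAr f) → Tm X) → Tm X
      nxt  : Tm X → Tm X
      ite  : Fm X → Tm X → Tm X → Tm X
      atF  : Tm X → Fm X → Tm X
      atP  : Tm X → Fm X → Tm X
      dfl  : Tm X → Tm X

  _∧f_ : ∀ {X} → Fm X → Fm X → Fm X
  a ∧f b = ¬f (¬f a ∨f ¬f b)

  _Rf_ : ∀ {X} → Fm X → Fm X → Fm X
  a Rf b = ¬f (¬f a Uf ¬f b)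

  Zf : ∀ {X} → Fm X → Fm X
  Zf a = ¬f (Yf (¬f a))

  mutual
    renF : ∀ {X Y} → (X → Y) → Fm X → Fm Y
    renF r ⊤f = ⊤f
    renF r ⊥f = ⊥f
    renF r (pr p as) = pr p (λ a → renT r (as a))
    renF r (bv x) = bv (r x)
    renF r (¬f φ) = ¬f renF r φ
    renF r (φ ∨f ψ) = renF r φ ∨f renF r ψ
    renF r (Xf φ) = Xf (renF r φ)
    renF r (Yf φ) = Yf (renF r φ)
    renF r (φ Uf ψ) = renF r φ Uf renF r ψ
    renF r (φ Sf ψ) = renF r φ Sf renF r ψ

    renT : ∀ {X Y} → (X → Y) → Tm X → Tm Y
    renT r (cst c) = cst c
    renT r (var x) = var (r x)
    renT r (fn f as) = fn f (λ a → renT r (as a))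
    renT r (nxt u) = nxt (renT r u)
    renT r (ite φ u v) = ite (renF r φ) (renT r u) (renT r v)
    renT r (atF u φ) = atF (renT r u) (renF r φ)
    renT r (atP u φ) = atP (renT r u) (renF r φ)
    renT r (dfl u) = dfl (renT r u)

  -- A term "contains an input variable or a subterm next(.) or .@F~." :
  -- the term is searched through its subterms (not inside formulas).
  hasIn : ∀ {X} → (X → Bool) → Tm X → Bool
  hasIn isI (cst c) = false
  hasIn isI (var x) = isI x
  hasIn isI (fn f as) = anyFin (λ a → hasIn isI (as a))
  hasIn isI (nxt u) = true
  hasIn isI (ite φ u v) = hasIn isI u ∨ hasIn isI v
  hasIn isI (atF u φ) = true
  hasIn isI (atP u φ) = hasIn isI u
  hasIn isI (dfl u) = false

  isInPred : ∀ {X} → (X → Bool) → ∀ {k} → (Fin k → Tm X) → Bool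
  isInPred isI as = anyFin (λ a → hasIn isI (as a))

  mutual
    AllVarsF : ∀ {X} → (X → Set) → Fm X → Set
    AllVarsF P ⊤f = ⊤
    AllVarsF P ⊥f = ⊤
    AllVarsF P (pr p as) = ∀ a → AllVarsT P (as a)
    AllVarsF P (bv x) = P x
    AllVarsF P (¬f φ) = AllVarsF P φ
    AllVarsF P (φ ∨f ψ) = AllVarsF P φ × AllVarsF P ψ
    AllVarsF P (Xf φ) = AllVarsF P φ
    AllVarsF P (Yf φ) = AllVarsF P φ
    AllVarsF P (φ Uf ψ) = AllVarsF P φ × AllVarsF P ψ
    AllVarsF P (φ Sf ψ) = AllVarsF P φ × AllVarsF P ψ

    AllVarsT : ∀ {X} → (X → Set) → Tm X → Set
    AllVarsT P (cst c) = ⊤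
    AllVarsT P (var x) = P x
    AllVarsT P (fn f as) = ∀ a → AllVarsT P (as a)
    AllVarsT P (nxt u) = AllVarsT P u
    AllVarsT P (ite φ u v) = AllVarsF P φ × AllVarsT P u × AllVarsT P v
    AllVarsT P (atF u φ) = AllVarsT P u × AllVarsF P φ
    AllVarsT P (atP u φ) = AllVarsT P u × AllVarsF P φ
    AllVarsT P (dfl u) = AllVarsT P u

-- The assignment at every position is a total function; values
-- at positions ≥ len, and values of input variables at the last position
-- of a finite trace, are irrelevant junk (never constrained).

record Trace (X D : Set) : Set where
  field
    len      : Len
    nonempty : 0 <L len
    st       : ℕ → X → D
open Trace public

module Semantics (S : Signature) (M : Structure S) where
  open Signature S
  open Structure M
  open Syntax S

  module _ {X : Set} (isI : X → Bool) (dflt : Tm X → D) (π : Trace X D) where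

    AtomO : Sgn → ℕ → Set → Set
    AtomO minus i P = ¬ (i <L len π) ⊎ P
    AtomO plus  i P = (i <L len π) × P

    AtomI : Sgn → ℕ → Set → Set
    AtomI minus i P = ¬ (suc i <L len π) ⊎ P
    AtomI plus  i P = (suc i <L len π) × P

    Atom : Sgn → Bool → ℕ → Set → Set
    Atom s true  i P = AtomI s i P
    Atom s false i P = AtomO s i P

    flip : Sgn → Sgn
    flip minus = plus
    flip plus = minus

    mutual
      Sat : Sgn → ℕ → Fm X → Set
      Sat s i ⊤f = AtomO s i ⊤
      Sat s i ⊥f = AtomO s i ⊥
      Sat s i (pr p as) =
        Atom s (isInPred isI as) i
          (Σ (Fin (predAr p) → D) λ vs → (∀ a → Ev i (as a) (vs a)) × predM p vs)
      Sat s i (bv x) = Atom s (isI x) i (T (bool (st π i x)))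
      Sat minus i (¬f φ) = ¬ Sat plus i φ
      Sat plus i (¬f φ) = ¬ Sat minus i φ
      Sat s i (φ ∨f ψ) = Sat s i φ ⊎ Sat s i ψ
      Sat s i (Xf φ) = Sat s (suc i) φ
      Sat s i (φ Uf ψ) =
        Σ ℕ λ k → i ≤ k × Sat s k ψ × (∀ l → i ≤ l → l < k → Sat s l φ)
      Sat minus zero (Yf φ) = ¬ (zero <L len π)
      Sat minus (suc i) (Yf φ) = ¬ (suc i <L len π) ⊎ Sat minus i φ
      Sat plus zero (Yf φ) = ⊥
      Sat plus (suc i) (Yf φ) = (suc i <L len π) × Sat plus i φ
      Sat minus i (φ Sf ψ) = ¬ (i <L len π) ⊎
        (Σ ℕ λ k → k ≤ i × Sat minus k ψ × (∀ l → k < l → l ≤ i → Sat minus l φ))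
      Sat plus i (φ Sf ψ) = (i <L len π) ×
        (Σ ℕ λ k → k ≤ i × Sat plus k ψ × (∀ l → k < l → l ≤ i → Sat plus l φ))

      Ev : ℕ → Tm X → D → Set
      Ev i (cst c) v = v ≡ constM c
      Ev i (var x) v = v ≡ st π i x
      Ev i (fn f as) v =
        Σ (Fin (funAr f) → D) λ vs → (∀ a → Ev i (as a) (vs a)) × v ≡ funM f vs
      Ev i (nxt u) v =
        (suc i <L len π × Ev (suc i) u v) ⊎ (¬ (suc i <L len π) × v ≡ dflt (nxt u))
      Ev i (ite φ u w) v =
        (Sat plus i φ × Ev i u v)
        ⊎ (¬ Sat plus i φ × ¬ Sat minus i φ × Ev i w v)
        ⊎ (¬ Sat plus i φ × ¬ ¬ Sat minus i φ × v ≡ dflt (ite φ u w))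
      Ev i (atF u φ) v =
        (Σ ℕ λ k → i < k × Sat plus k φ × (∀ l → i < l → l < k → ¬ Sat minus l φ)
                   × Ev k u v)
        ⊎ (¬ (Σ ℕ λ k → i < k × Sat plus k φ × (∀ l → i < l → l < k → ¬ Sat minus l φ))
           × v ≡ dflt (atF u φ))
      Ev i (atP u φ) v =
        (Σ ℕ λ k → k < i × Sat plus k φ × (∀ l → k < l → l < i → ¬ Sat minus l φ)
                   × Ev k u v)
        ⊎ (¬ (Σ ℕ λ k → k < i × Sat plus k φ × (∀ l → k < l → l < i → ¬ Sat minus l φ))
           × v ≡ dflt (atP u φ))
      Ev i (dfl u) v = v ≡ dflt u

-- Interacting transition systems (conditions given semantically, with
-- proofs that they only depend on the variables they are "over")

data VK : Set where
  inp out none : VK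

isInpK isOutK isVarK : VK → Bool
isInpK inp = true
isInpK _   = false
isOutK out = true
isOutK _   = false
isVarK none = false
isVarK _    = true

AgreeOn : ∀ {X D : Set} → (X → Set) → (X → D) → (X → D) → Set
AgreeOn P s t = ∀ x → P x → s x ≡ t x

record FairPair (X D : Set) : Set₁ where
  field
    fA fG : (X → D) → Set

record ITS (X D : Set) : Set₁ where
  field
    kind  : X → VK
    Init  : (X → D) → Set
    Trans : (X → D) → (X → D) → Set
    SF    : List (FairPair X D)
    Init-loc  : ∀ s t → AgreeOn (λ x → T (isOutK (kind x))) s t → Init s → Init t
    Trans-loc : ∀ s s' t t' → AgreeOn (λ x → T (isVarK (kind x))) s t →
                AgreeOn (λ x → T (isOutK (kind x))) s' t' → Trans s s' → Trans t t'
    SF-loc    : ∀ p → p ∈ SF → ∀ s t → AgreeOn (λ x → T (isVarK (kind x))) s t →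
                (FairPair.fA p s → FairPair.fA p t) × (FairPair.fG p s → FairPair.fG p t)

InfOften : ∀ {X D : Set} → Trace X D → ((X → D) → Set) → Set
InfOften π P = ∀ N → Σ ℕ λ k → N ≤ k × P (st π k)

IsTraceOf : ∀ {X D : Set} → ITS X D → Trace X D → Set₁
IsTraceOf M π =
  ITS.Init M (st π 0)
  × (∀ k → suc k <L len π → ITS.Trans M (st π k) (st π (suc k)))
  × (len π ≡ nothing → ∀ p → p ∈ ITS.SF M →
       InfOften π (FairPair.fA p) → InfOften π (FairPair.fG p))

Compatible : ∀ {X D : Set} {n} → (Fin n → ITS X D) → Set
Compatible {X} Ms = ∀ a b → ¬ (a ≡ b) → ∀ (x : X) →
  T (isVarK (ITS.kind (Ms a) x)) → T (isVarK (ITS.kind (Ms b) x)) →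
  (T (isOutK (ITS.kind (Ms a) x)) × T (isInpK (ITS.kind (Ms b) x)))
  ⊎ (T (isInpK (ITS.kind (Ms a) x)) × T (isOutK (ITS.kind (Ms b) x)))

data CVar (X : Set) (n : ℕ) : Set where
  base : X → CVar X n
  run  : Fin n → CVar X n
  end  : Fin n → CVar X n

module Composition {X D : Set} (bool : D → Bool) {n : ℕ} (Ms : Fin n → ITS X D) where

  kd : Fin n → X → VK
  kd j = ITS.kind (Ms j)

  shared : X → Bool
  shared x = any (λ a → any (λ b → (toℕ a <ᵇ toℕ b) ∧ isVarK (kd a x) ∧ isVarK (kd b x))
                         (allFin n)) (allFin n)

  isInpC : CVar X n → Bool
  isInpC (base x) = not (shared x) ∧ any (λ j → isInpK (kd j x)) (allFin n)
  isInpC (run j)  = true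
  isInpC (end j)  = false

  RunAt EndAt : Trace (CVar X n) D → Fin n → ℕ → Set
  RunAt π j k = T (bool (st π k (run j)))
  EndAt π j k = T (bool (st π k (end j)))

  IsTraceC : Trace (CVar X n) D → Set₁
  IsTraceC π =
    (∀ j → ITS.Init (Ms j) (λ x → st π 0 (base x)))
    × (∀ k → suc k <L len π → ∀ j →
         (RunAt π j k → ITS.Trans (Ms j) (λ x → st π k (base x)) (λ x → st π (suc k) (base x)))
         × (¬ RunAt π j k → ∀ x → T (isOutK (kd j x)) → st π k (base x) ≡ st π (suc k) (base x))
         × (EndAt π j k ⇔ (EndAt π j (suc k) × ¬ RunAt π j k)))
    × (len π ≡ nothing → ∀ j →
         (InfOften π (λ _ → ⊤) →
            InfOften π (λ s → T (bool (s (run j)) ∨ bool (s (end j)))))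
         × (∀ p → p ∈ ITS.SF (Ms j) →
              InfOften π (λ s → T (bool (s (run j))) × FairPair.fA p (λ x → s (base x))) →
              InfOften π (λ s → T (bool (s (run j))) × FairPair.fG p (λ x → s (base x)))))

  -- Projection Pr_i.  run_i is an input of C, hence only defined at
  -- positions p with p + 1 < |π'|.
  module Proj (i : Fin n) (π' : Trace (CVar X n) D) where

    runB : ℕ → Bool
    runB p = (suc p <ᵇL len π') ∧ bool (st π' p (run i))

    cnt : ℕ → ℕ
    cnt zero = zero
    cnt (suc m) = cnt m + (if runB m then 1 else 0)

    IsMap : ℕ → ℕ → Set
    IsMap k m =
      (T (runB m) × cnt m ≡ k)
      ⊎ (cnt m ≡ k × (∀ p → m ≤ p → ¬ T (runB p))
         × (m ≡ 0 ⊎ Σ ℕ λ m' → m ≡ suc m' × T (runB m')))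

    -- map_{k-1} < j   (map_{-1} = -1)
    AfterPrev : ℕ → ℕ → Set
    AfterPrev zero j = ⊤
    AfterPrev (suc k) j = Σ ℕ λ m' → IsMap k m' × m' < j

    ProjEq : Trace X D → Set
    ProjEq π =
      (∀ k → (k <L len π) ⇔ (Σ ℕ λ m → IsMap k m))
      × (∀ k m → IsMap k m → ∀ x → T (isOutK (kd i x)) → st π k x ≡ st π' m (base x))
      × (∀ k m → IsMap k m → T (runB m) → ∀ x → T (isInpK (kd i x)) →
           st π k x ≡ st π' m (base x))

module Rewriting (S : Signature) where
  open Signature S
  open Syntax S

  module _ {X : Set} {n : ℕ} (i : Fin n) (isI : X → Bool) where

    runF endF stateF : Fm (CVar X n)
    runF = bv (run i)
    endF = bv (end i)
    stateF = runF ∨f (Zf runF ∧f endF)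

    inAtom : Sgn → Fm (CVar X n) → Fm (CVar X n)
    inAtom minus φ = ¬f runF ∨f φ
    inAtom plus  φ = runF ∧f φ

    mutual
      R : Sgn → Fm X → Fm (CVar X n)
      R s ⊤f = ⊤f
      R s ⊥f = ⊥f
      R s (pr p as) = if isInPred isI as
                        then inAtom s (pr p (λ a → RT s (as a)))
                        else pr p (λ a → RT s (as a))
      R s (bv x) = if isI x then inAtom s (bv (base x)) else bv (base x)
      R minus (¬f φ) = ¬f R plus φ
      R plus (¬f φ) = ¬f R minus φ
      R s (φ ∨f ψ) = R s φ ∨f R s ψ
      R minus (Xf φ) = Xf (stateF Rf (¬f stateF ∨f R minus φ))
      R plus (Xf φ) = Xf (¬f stateF Uf (stateF ∧f R plus φ))
      R minus (φ Uf ψ) =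
        (¬f stateF ∨f R minus φ) Uf ((stateF ∧f R minus ψ) ∨f Yf endF)
      R plus (φ Uf ψ) = (¬f stateF ∨f R plus φ) Uf (stateF ∧f R plus ψ)
      R s (Yf φ) = Yf (¬f runF Sf (runF ∧f R s φ))
      R s (φ Sf ψ) = (¬f stateF ∨f R s φ) Sf (stateF ∧f R s ψ)

      RT : Sgn → Tm X → Tm (CVar X n)
      RT s (cst c) = cst c
      RT s (var x) = var (base x)
      RT s (fn f as) = fn f (λ a → RT s (as a))
      RT s (nxt u) = atF (RT s u) stateF
      -- R^+(¬φ) = ¬ R^-(φ)
      RT s (ite φ u w) =
        ite (R plus φ) (RT minus u)
            (ite (¬f R minus φ) (RT minus w) (dfl (renT base (ite φ u w))))
      RT s (atF u φ) = atF (RT s u) (stateF ∧f R plus φ)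
      RT s (atP u φ) = atP (RT s u) (stateF ∧f R plus φ)
      RT s (dfl u) = dfl (renT base u)

  module _ {X : Set} (kd : X → VK) where
    mutual
      data STF : Fm X → Set where
        st-∨   : ∀ {φ ψ} → STF φ → STF ψ → STF (φ ∨f ψ)
        st-¬   : ∀ {φ} → STF φ → STF (¬f φ)
        st-⊤   : STF ⊤f
        st-⊥   : STF ⊥f
        st-pr  : ∀ {p as} → T (not (isInPred (λ x → isInpK (kd x)) as)) →
                 (∀ a → STT (as a)) → STF (pr p as)
        st-bv  : ∀ {x} → T (isOutK (kd x)) → STF (bv x)
        st-U   : ∀ φ ψ → STF (φ Uf ψ)
        st-Y   : ∀ φ → STF (Yf φ)

      data STT : Tm X → Set where
        st-fn  : ∀ {f as} → (∀ a → STT (as a)) → STT (fn f as)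
        st-var : ∀ {x} → T (isOutK (kd x)) → STT (var x)
        st-cst : ∀ {c} → STT (cst c)
        st-dfl : ∀ {u} → STT (dfl u)
        st-ite : ∀ {φ u w} → STF φ → STT u → STT w → STT (ite φ u w)
        st-atP : ∀ u φ → STT (atP u φ)

-- Between two consecutive run_i-positions of a trace of the composition,
-- component i is idle: run_i is false, end_i is false (an end_i would have to
-- persist up to the next run_i, which it forbids), and the outputs of M_i are
-- frozen by the frame condition.  Hence on such a block every output atom
-- keeps its value, state_i is false, and the rewritten operators all wait for
-- the next state_i-position: U, @P and Y(¬run S ...) see exactly the same
-- witnesses from any position of the block as from map_k.  The syntactic
-- restrictions of stutter tolerance exclude precisely the constructs (X,
-- input atoms, next, @F) that look at the idle block itself.

module Submission where

open import Defs
open import Function using (_∘_)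
open import Data.Nat using (ℕ; zero; suc; _<_; _≤_; _≤′_; ≤′-refl; ≤′-step; z≤n; s≤s; _<?_)
open import Data.Nat.Properties
open import Data.Bool using (Bool; true; false; T)
open import Data.Bool.Properties using (T-∧; T-not-≡; ∨-conicalˡ; ∨-conicalʳ)
open import Data.Bool.ListAction using (any)
open import Data.Fin using (Fin; toℕ) renaming (zero to fzero; suc to fsuc)
open import Data.Fin.Properties using (toℕ-injective)
open import Data.Maybe using (just; nothing)
open import Data.Product using (Σ; _×_; _,_; proj₁; proj₂) renaming (map to map×)
open import Data.Sum using (_⊎_; inj₁; inj₂; [_,_]′) renaming (map to map⊎)
open import Data.Unit using (tt)
open import Data.Empty using (⊥-elim)
open import Data.List using (allFin)
open import Data.List.Relation.Unary.Any using (satisfied)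
open import Data.List.Relation.Unary.Any.Properties using (any⁺; any⁻)
open import Data.List.Membership.Propositional using (lose)
open import Data.List.Membership.Propositional.Properties using (∈-allFin)
open import Function.Bundles using (Equivalence)
open import Relation.Binary.Definitions using (tri<; tri≈; tri>)
open import Relation.Nullary using (¬_; yes; no)
open import Relation.Binary.PropositionalEquality using (_≡_; _≢_; refl; sym; trans; subst; cong)

⇔-refl : ∀ {A} → A ⇔ A
⇔-refl = (λ a → a) , (λ a → a)

⇔-sym : ∀ {A B} → A ⇔ B → B ⇔ A
⇔-sym (f , g) = g , f

⇔-trans : ∀ {A B C} → A ⇔ B → B ⇔ C → A ⇔ C
⇔-trans (f , g) (h , k) = h ∘ f , g ∘ k

⇔-¬ : ∀ {A B} → A ⇔ B → (¬ A) ⇔ (¬ B)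
⇔-¬ (f , g) = (λ ¬a → ¬a ∘ g) , (λ ¬b → ¬b ∘ f)

⇔-⊎ : ∀ {A B C D} → A ⇔ B → C ⇔ D → (A ⊎ C) ⇔ (B ⊎ D)
⇔-⊎ (f , g) (h , k) = map⊎ f h , map⊎ g k

⇔-× : ∀ {A B C D} → A ⇔ B → C ⇔ D → (A × C) ⇔ (B × D)
⇔-× (f , g) (h , k) = map× f h , map× g k

⇔-empty : ∀ {A B} → ¬ A → ¬ B → A ⇔ B
⇔-empty ¬a ¬b = ⊥-elim ∘ ¬a , ⊥-elim ∘ ¬b

≤-propagate : ∀ (P : ℕ → Set) {j m} → j ≤ m →
              (∀ p → j ≤ p → p < m → P p → P (suc p)) → P j → P m
≤-propagate P {j} j≤m step = go (≤⇒≤′ j≤m) step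
  where
  go : ∀ {m} → j ≤′ m → (∀ p → j ≤ p → p < m → P p → P (suc p)) → P j → P m
  go ≤′-refl           _    Pj = Pj
  go (≤′-step {m} j≤m) step Pj =
    step m (≤′⇒≤ j≤m) ≤-refl (go j≤m (λ p j≤p p<m → step p j≤p (m<n⇒m<1+n p<m)) Pj)

anyFin-false : ∀ {n} (f : Fin n → Bool) → (∀ a → f a ≡ false) → anyFin f ≡ false
anyFin-false {zero}  f all-false = refl
anyFin-false {suc n} f all-false
  rewrite all-false fzero | anyFin-false (f ∘ fsuc) (all-false ∘ fsuc) = refl

anyFin-false⁻ : ∀ {n} (f : Fin n → Bool) → anyFin f ≡ false → ∀ a → f a ≡ false
anyFin-false⁻ {suc n} f all-false fzero    = ∨-conicalˡ (f fzero) _ all-false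
anyFin-false⁻ {suc n} f all-false (fsuc a) = anyFin-false⁻ (f ∘ fsuc) (∨-conicalʳ (f fzero) _ all-false) a

<L-≤-trans : ∀ {p q} L → p ≤ q → q <L L → p <L L
<L-≤-trans nothing  _   _   = tt
<L-≤-trans (just n) p≤q q<n = ≤-<-trans p≤q q<n

<ᵇL⇒<L : ∀ {p} L → T (p <ᵇL L) → p <L L
<ᵇL⇒<L         nothing  _ = tt
<ᵇL⇒<L {p} (just n) t = <ᵇ⇒< p n t

<L⇒<ᵇL : ∀ {p} L → p <L L → T (p <ᵇL L)
<L⇒<ᵇL nothing  _   = tt
<L⇒<ᵇL (just n) p<n = <⇒<ᵇ p<n

isInp⇒isVar : ∀ {k} → T (isInpK k) → T (isVarK k)
isInp⇒isVar {inp} _ = tt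

isOut⇒isVar : ∀ {k} → T (isOutK k) → T (isVarK k)
isOut⇒isVar {out} _ = tt

isVar∧¬isInp⇒isOut : ∀ {k} → T (isVarK k) → isInpK k ≡ false → T (isOutK k)
isVar∧¬isInp⇒isOut {out} _ _ = tt

isOut⇒¬isInp : ∀ {k} → T (isOutK k) → isInpK k ≡ false
isOut⇒¬isInp {out} _ = refl

module Steadiness (S : Signature) (M : Structure S) {Y : Set} (isI : Y → Bool)
  (dflt : Syntax.Tm S Y → Structure.D M) (π : Trace Y (Structure.D M)) where
  open Structure M
  open Syntax S

  private
    Sat : Sgn → ℕ → Fm Y → Set
    Sat = Semantics.Sat S M isI dflt π

    Ev : ℕ → Tm Y → D → Set
    Ev = Semantics.Ev S M isI dflt π

    Atom : Sgn → Bool → ℕ → Set → Set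
    Atom = Semantics.Atom S M isI dflt π

    variable
      j m p q k : ℕ
      s : Sgn
      x : Y
      φ ψ : Fm Y
      u w : Tm Y

  record Refuted (p : ℕ) (φ : Fm Y) : Set where
    constructor refuted
    field refutes : ∀ s → ¬ Sat s p φ
  open Refuted public

  ¬-refuted : Refuted p φ → ∀ s → Sat s p (¬f φ)
  ¬-refuted ¬φ minus = refutes ¬φ plus
  ¬-refuted ¬φ plus  = refutes ¬φ minus

  ∨-refuted : Refuted p φ → Refuted p ψ → Refuted p (φ ∨f ψ)
  ∨-refuted ¬φ ¬ψ = refuted λ s → [ refutes ¬φ s , refutes ¬ψ s ]′

  ∧-refutedˡ : Refuted p φ → Refuted p (φ ∧f ψ)
  ∧-refutedˡ ¬φ = refuted λ where
    minus φ∧ψ → φ∧ψ (inj₁ (refutes ¬φ minus))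
    plus  φ∧ψ → φ∧ψ (inj₁ (refutes ¬φ plus))

  ∧-refutedʳ : Refuted p ψ → Refuted p (φ ∧f ψ)
  ∧-refutedʳ ¬ψ = refuted λ where
    minus φ∧ψ → φ∧ψ (inj₂ (refutes ¬ψ minus))
    plus  φ∧ψ → φ∧ψ (inj₂ (refutes ¬ψ plus))

  output-atom-refuted : ∀ {b} {P : Set} → b ≡ false → p <L len π → ¬ P → ∀ s → ¬ Atom s b p P
  output-atom-refuted refl p<len ¬P minus = [ (λ ¬p<len → ¬p<len p<len) , ¬P ]′
  output-atom-refuted refl p<len ¬P plus  = ¬P ∘ proj₂

  input-atom-refuted : ∀ {b} {P : Set} → b ≡ true → suc p <L len π → ¬ P → ∀ s → ¬ Atom s b p P
  input-atom-refuted refl p<len ¬P minus = [ (λ ¬p<len → ¬p<len p<len) , ¬P ]′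
  input-atom-refuted refl p<len ¬P plus  = ¬P ∘ proj₂

  output-bv-refuted : isI x ≡ false → p <L len π → ¬ T (bool (st π p x)) → Refuted p (bv x)
  output-bv-refuted eq p<len ¬x = refuted (output-atom-refuted eq p<len ¬x)

  input-bv-refuted : isI x ≡ true → suc p <L len π → ¬ T (bool (st π p x)) → Refuted p (bv x)
  input-bv-refuted eq p<len ¬x = refuted (input-atom-refuted eq p<len ¬x)

  record Steady (j m : ℕ) (φ : Fm Y) : Set where
    constructor steady
    field steady-sat : ∀ s → Sat s j φ ⇔ Sat s m φ
  open Steady public

  record SteadyT (j m : ℕ) (u : Tm Y) : Set where
    constructor steadyT
    field steady-ev : ∀ v → Ev j u v ⇔ Ev m u v
  open SteadyT public

  ¬-steady : Steady j m φ → Steady j m (¬f φ)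
  ¬-steady φ≈ = steady λ where
    minus → ⇔-¬ (steady-sat φ≈ plus)
    plus  → ⇔-¬ (steady-sat φ≈ minus)

  ∨-steady : Steady j m φ → Steady j m ψ → Steady j m (φ ∨f ψ)
  ∨-steady φ≈ ψ≈ = steady λ s → ⇔-⊎ (steady-sat φ≈ s) (steady-sat ψ≈ s)

  output-atom-steady : ∀ {b} {P Q : Set} → b ≡ false → j <L len π → m <L len π → P ⇔ Q →
                       ∀ s → Atom s b j P ⇔ Atom s b m Q
  output-atom-steady refl j<len m<len P⇔Q minus =
    ⇔-⊎ (⇔-empty (λ ¬j → ¬j j<len) (λ ¬m → ¬m m<len)) P⇔Q
  output-atom-steady refl j<len m<len P⇔Q plus  =
    ⇔-× ((λ _ → m<len) , (λ _ → j<len)) P⇔Q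

  args-steady : ∀ {a} {as : Fin a → Tm Y} (F : (Fin a → D) → Set) → (∀ b → SteadyT j m (as b)) →
                (Σ (Fin a → D) λ vs → (∀ b → Ev j (as b) (vs b)) × F vs)
                ⇔ (Σ (Fin a → D) λ vs → (∀ b → Ev m (as b) (vs b)) × F vs)
  args-steady F as≈ = (λ (vs , ev , f) → vs , (λ b → proj₁ (steady-ev (as≈ b) (vs b)) (ev b)) , f)
                    , (λ (vs , ev , f) → vs , (λ b → proj₂ (steady-ev (as≈ b) (vs b)) (ev b)) , f)

  ite-steady : Steady j m φ → SteadyT j m u → SteadyT j m w → SteadyT j m (ite φ u w)
  ite-steady (steady φ≈) (steadyT u≈) (steadyT w≈) = steadyT λ v →
    ⇔-⊎ (⇔-× (φ≈ plus) (u≈ v))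
        (⇔-⊎ (⇔-× (⇔-¬ (φ≈ plus)) (⇔-× (⇔-¬ (φ≈ minus)) (w≈ v)))
             (⇔-× (⇔-¬ (φ≈ plus)) (⇔-× (⇔-¬ (⇔-¬ (φ≈ minus))) ⇔-refl)))

  atP-steady : j ≤ m → (∀ l → j ≤ l → l < m → Refuted l φ) → SteadyT j m (atP u φ)
  atP-steady {j} {m} {φ} {u} j≤m ¬φ = steadyT λ v →
    ⇔-⊎ ((λ (k , k<j , φk , gap , ev) → k , <-≤-trans k<j j≤m , φk , widen gap , ev)
        , (λ (k , k<m , φk , gap , ev) → k , below-j k<m φk , φk , narrow gap , ev))
        (⇔-× (⇔-¬ ((λ (k , k<j , φk , gap) → k , <-≤-trans k<j j≤m , φk , widen gap)
                  , (λ (k , k<m , φk , gap) → k , below-j k<m φk , φk , narrow gap)))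
             ⇔-refl)
    where
    Gap : ℕ → ℕ → Set
    Gap i k = ∀ l → k < l → l < i → ¬ Sat minus l φ

    below-j : k < m → Sat plus k φ → k < j
    below-j {k} k<m φk with k <? j
    ... | yes k<j = k<j
    ... | no  k≮j = ⊥-elim (refutes (¬φ k (≮⇒≥ k≮j) k<m) plus φk)

    widen : Gap j k → Gap m k
    widen gap l k<l l<m with l <? j
    ... | yes l<j = gap l k<l l<j
    ... | no  l≮j = refutes (¬φ l (≮⇒≥ l≮j) l<m) minus

    narrow : Gap m k → Gap j k
    narrow gap l k<l l<j = gap l k<l (<-≤-trans l<j j≤m)

  Blocked : Sgn → Fm Y → Fm Y → ℕ → ℕ → Set
  Blocked s A B j m = ∀ l → j ≤ l → l < m → Sat s l A × ¬ Sat s l B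

  U-steady : ∀ s A B → j ≤ m → Blocked s A B j m → Sat s j (A Uf B) ⇔ Sat s m (A Uf B)
  U-steady {j} {m} s A B j≤m blocked = to , from
    where
    to : Sat s j (A Uf B) → Sat s m (A Uf B)
    to (k , j≤k , Bk , A-until) with m ≤? k
    ... | yes m≤k = k , m≤k , Bk , (λ l m≤l l<k → A-until l (≤-trans j≤m m≤l) l<k)
    ... | no  m≰k = ⊥-elim (proj₂ (blocked k j≤k (≰⇒> m≰k)) Bk)

    from : Sat s m (A Uf B) → Sat s j (A Uf B)
    from (k , m≤k , Bk , A-until) = k , ≤-trans j≤m m≤k , Bk , A-from-j
      where
      A-from-j : ∀ l → j ≤ l → l < k → Sat s l A
      A-from-j l j≤l l<k with m ≤? l
      ... | yes m≤l = A-until l m≤l l<k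
      ... | no  m≰l = proj₁ (blocked l j≤l (≰⇒> m≰l))

  Since : Sgn → Fm Y → Fm Y → ℕ → Set
  Since s A B p = Σ ℕ λ k → k ≤ p × Sat s k B × (∀ l → k < l → l ≤ p → Sat s l A)

  since-steady : ∀ s A B → q ≤ p → Blocked s A B (suc q) (suc p) → Since s A B q ⇔ Since s A B p
  since-steady {q} {p} s A B q≤p blocked = to , from
    where
    to : Since s A B q → Since s A B p
    to (k , k≤q , Bk , A-since) = k , ≤-trans k≤q q≤p , Bk , A-to-p
      where
      A-to-p : ∀ l → k < l → l ≤ p → Sat s l A
      A-to-p l k<l l≤p with l ≤? q
      ... | yes l≤q = A-since l k<l l≤q
      ... | no  l≰q = proj₁ (blocked l (≰⇒> l≰q) (s≤s l≤p))

    from : Since s A B p → Since s A B q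
    from (k , k≤p , Bk , A-since) with k ≤? q
    ... | yes k≤q = k , k≤q , Bk , (λ l k<l l≤q → A-since l k<l (≤-trans l≤q q≤p))
    ... | no  k≰q = ⊥-elim (proj₂ (blocked k (≰⇒> k≰q) (s≤s k≤p)) Bk)

  S-steady : ∀ s A B → q ≤ p → p <L len π → Blocked s A B (suc q) (suc p) →
             Sat s q (A Sf B) ⇔ Sat s p (A Sf B)
  S-steady minus A B q≤p p<len blocked =
    ⇔-⊎ (⇔-empty (λ ¬q → ¬q (<L-≤-trans (len π) q≤p p<len)) (λ ¬p → ¬p p<len))
        (since-steady minus A B q≤p blocked)
  S-steady plus  A B q≤p p<len blocked =
    ⇔-× ((λ _ → p<len) , (λ _ → <L-≤-trans (len π) q≤p p<len))
        (since-steady plus A B q≤p blocked)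

  Y-suc : ∀ s φ → suc p <L len π → Sat s (suc p) (Yf φ) ⇔ Sat s p φ
  Y-suc minus φ p<len = [ (λ ¬p<len → ⊥-elim (¬p<len p<len)) , (λ φp → φp) ]′ , inj₂
  Y-suc plus  φ p<len = proj₂ , (λ φp → p<len , φp)

  YS-steady : ∀ s A B → j ≤ m → m <L len π → Blocked s A B j m →
              Sat s j (Yf (A Sf B)) ⇔ Sat s m (Yf (A Sf B))
  YS-steady {zero}  {zero}  _ _ _ _ _ _ = ⇔-refl
  YS-steady {zero}  {suc p} s A B _ m<len blocked =
    ⇔-empty (Y-at-0 s) (no-since s blocked ∘ proj₁ (Y-suc s (A Sf B) m<len))
    where
    Y-at-0 : ∀ s → ¬ Sat s zero (Yf (A Sf B))
    Y-at-0 minus ¬0<len = ¬0<len (nonempty π)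
    Y-at-0 plus  ()

    no-since : ∀ s → Blocked s A B 0 (suc p) → ¬ Sat s p (A Sf B)
    no-since minus blocked (inj₁ ¬p<len) = ¬p<len (<L-≤-trans (len π) (n≤1+n p) m<len)
    no-since minus blocked (inj₂ (k , k≤p , Bk , _)) = proj₂ (blocked k z≤n (s≤s k≤p)) Bk
    no-since plus  blocked (_ , k , k≤p , Bk , _) = proj₂ (blocked k z≤n (s≤s k≤p)) Bk
  YS-steady {suc q} {suc p} s A B (s≤s q≤p) m<len blocked =
    ⇔-trans (Y-suc s (A Sf B) (<L-≤-trans (len π) (s≤s q≤p) m<len))
      (⇔-trans (S-steady s A B q≤p (<L-≤-trans (len π) (n≤1+n p) m<len) blocked)
               (⇔-sym (Y-suc s (A Sf B) m<len)))

module ComponentVariables {X D : Set} (bool : D → Bool) {n : ℕ} (Ms : Fin n → ITS X D)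
  (i : Fin n) where
  open Composition bool Ms using (kd; shared; isInpC)

  shared-intro : ∀ {x} a b → toℕ a < toℕ b → T (isVarK (kd a x)) → T (isVarK (kd b x)) →
                 T (shared x)
  shared-intro a b a<b va vb =
    any⁺ _ (lose (∈-allFin a)
      (any⁺ _ (lose (∈-allFin b)
        (Equivalence.from T-∧ (<⇒<ᵇ a<b , Equivalence.from T-∧ (va , vb))))))

  distinct-vars-shared : ∀ {x a b} → a ≢ b → T (isVarK (kd a x)) → T (isVarK (kd b x)) →
                         T (shared x)
  distinct-vars-shared {a = a} {b} a≢b var-a var-b with <-cmp (toℕ a) (toℕ b)
  ... | tri< a<b _ _ = shared-intro a b a<b var-a var-b
  ... | tri≈ _ a≡b _ = ⊥-elim (a≢b (toℕ-injective a≡b))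
  ... | tri> _ _ b<a = shared-intro b a b<a var-b var-a

  output-not-inputC : ∀ {x} → T (isOutK (kd i x)) → isInpC (base x) ≡ false
  output-not-inputC {x} out-i with shared x in not-shared
  ... | true = refl
  ... | false with any (λ a → isInpK (kd a x)) (allFin n) in some-input
  ...   | false = refl
  ...   | true  with satisfied (any⁻ _ (allFin n) (subst T (sym some-input) tt))
  ...     | a , inp-a =
    ⊥-elim (subst T not-shared
      (distinct-vars-shared (λ { refl → subst T (isOut⇒¬isInp out-i) inp-a })
                            (isInp⇒isVar inp-a) (isOut⇒isVar out-i)))

  IsVarᵢ : X → Set
  IsVarᵢ x = T (isVarK (kd i x))

  isInpᵢ : X → Bool
  isInpᵢ x = isInpK (kd i x)

  module _ (S : Signature) where
    open Syntax S
    open Rewriting S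

    RT-no-input : ∀ s u → AllVarsT IsVarᵢ u → hasIn isInpᵢ u ≡ false →
                  hasIn isInpC (RT i isInpᵢ s u) ≡ false
    RT-no-input s (cst c)     _ _ = refl
    RT-no-input s (var x)     var-x no-inp = output-not-inputC (isVar∧¬isInp⇒isOut var-x no-inp)
    RT-no-input s (fn f as)   vars no-inp =
      anyFin-false _ (λ a → RT-no-input s (as a) (vars a) (anyFin-false⁻ _ no-inp a))
    RT-no-input s (nxt u)     _ ()
    RT-no-input s (ite φ u w) (_ , vars-u , vars-w) no-inp
      rewrite RT-no-input minus u vars-u (∨-conicalˡ _ _ no-inp)
            | RT-no-input minus w vars-w (∨-conicalʳ (hasIn isInpᵢ u) _ no-inp) = refl
    RT-no-input s (atF u φ)   _ ()
    RT-no-input s (atP u φ)   (vars-u , _) no-inp = RT-no-input s u vars-u no-inp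
    RT-no-input s (dfl u)     _ _ = refl

module Counting {X D : Set} (bool : D → Bool) {n : ℕ} (Ms : Fin n → ITS X D) (i : Fin n)
  (π' : Trace (CVar X n) D) where
  open Composition.Proj bool Ms i π'

  private variable
    j k m p q : ℕ

  cnt-run : T (runB p) → cnt (suc p) ≡ suc (cnt p)
  cnt-run {p} r with runB p
  ... | true = +-comm (cnt p) 1

  cnt-mono : p ≤ q → cnt p ≤ cnt q
  cnt-mono {p} p≤q =
    ≤-propagate (λ q → cnt p ≤ cnt q) p≤q (λ q _ _ h → ≤-trans h (m≤m+n (cnt q) _)) ≤-refl

  isMap⇒cnt : IsMap k m → cnt m ≡ k
  isMap⇒cnt (inj₁ (_ , c)) = c
  isMap⇒cnt (inj₂ (c , _)) = c

  afterPrev-run⇒≤cnt : AfterPrev k j → j ≤ p → T (runB p) → k ≤ cnt p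
  afterPrev-run⇒≤cnt {zero} _ _ _ = z≤n
  afterPrev-run⇒≤cnt {suc k} {p = p} (m' , inj₁ (run-m' , cnt-m') , m'<j) j≤p _ =
    subst (_≤ cnt p) (trans (cnt-run run-m') (cong suc cnt-m')) (cnt-mono (≤-trans m'<j j≤p))
  afterPrev-run⇒≤cnt {suc k} (m' , inj₂ (_ , no-run-after , _) , m'<j) j≤p run-p =
    ⊥-elim (no-run-after _ (≤-trans (<⇒≤ m'<j) j≤p) run-p)

  idle-before-map : IsMap k m → AfterPrev k j → j ≤ p → p < m → ¬ T (runB p)
  idle-before-map {k} {m} {p = p} im ap j≤p p<m run-p = 1+n≰n (begin
    suc (cnt p)  ≡⟨ cnt-run run-p ⟨
    cnt (suc p)  ≤⟨ cnt-mono p<m ⟩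
    cnt m        ≡⟨ isMap⇒cnt im ⟩
    k            ≤⟨ afterPrev-run⇒≤cnt ap j≤p run-p ⟩
    cnt p        ∎)
    where open ≤-Reasoning

  -- map_k can only be the position after the last run_i if map_{k-1} is that
  -- last run_i itself, which leaves no room for j.
  runs-at-map : IsMap k m → AfterPrev k j → j < m → T (runB m)
  runs-at-map (inj₁ (run-m , _)) _ _ = run-m
  runs-at-map (inj₂ (_ , _ , inj₁ refl)) _ ()
  runs-at-map im@(inj₂ (_ , _ , inj₂ (m' , refl , run-m'))) ap (s≤s j≤m') =
    ⊥-elim (idle-before-map im ap j≤m' ≤-refl run-m')

module Stuttering (S : Signature) (M : Structure S) (X : Set) (n : ℕ)
  (Ms : Fin n → ITS X (Structure.D M)) (i : Fin n)
  (π' : Trace (CVar X n) (Structure.D M))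
  (tc : Composition.IsTraceC (Structure.bool M) Ms π')
  (dflt : Syntax.Tm S (CVar X n) → Structure.D M)
  (j m : ℕ) (j<m : j < m)
  (run-m : T (Composition.Proj.runB (Structure.bool M) Ms i π' m))
  (idle : ∀ p → j ≤ p → p < m → ¬ T (Composition.Proj.runB (Structure.bool M) Ms i π' p))
  where
  open Structure M
  open Syntax S
  open Rewriting S
  open Composition bool Ms using (kd; isInpC; RunAt; EndAt)
  open Steadiness S M isInpC dflt π'
  open ComponentVariables bool Ms i

  private variable
    p : ℕ

  j≤m : j ≤ m
  j≤m = <⇒≤ j<m

  suc-m<len : suc m <L len π'
  suc-m<len = <ᵇL⇒<L (len π') (proj₁ (Equivalence.to T-∧ run-m))

  <len : p ≤ suc m → p <L len π'
  <len p≤ = <L-≤-trans (len π') p≤ suc-m<len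

  frame : ∀ q → q ≤ m → ¬ RunAt π' i q →
          ∀ x → T (isOutK (kd i x)) → st π' q (base x) ≡ st π' (suc q) (base x)
  frame q q≤m = proj₁ (proj₂ (proj₁ (proj₂ tc) q (<len (s≤s q≤m)) i))

  end-step : ∀ q → q ≤ m → EndAt π' i q → EndAt π' i (suc q) × ¬ RunAt π' i q
  end-step q q≤m = proj₁ (proj₂ (proj₂ (proj₁ (proj₂ tc) q (<len (s≤s q≤m)) i)))

  idle-run : j ≤ p → p < m → ¬ RunAt π' i p
  idle-run {p} j≤p p<m r =
    idle p j≤p p<m (Equivalence.from T-∧ (<L⇒<ᵇL (len π') (<len (m<n⇒m<1+n p<m)) , r))

  end-false : p ≤ m → ¬ EndAt π' i p
  end-false p≤m end-p = proj₂ (end-step m ≤-refl end-m) (proj₂ (Equivalence.to T-∧ run-m))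
    where
    end-m : EndAt π' i m
    end-m = ≤-propagate (EndAt π' i) p≤m
              (λ q _ q<m → proj₁ ∘ end-step q (<⇒≤ q<m)) end-p

  outputs-frozen : ∀ {x} → T (isOutK (kd i x)) → st π' j (base x) ≡ st π' m (base x)
  outputs-frozen {x} is-out =
    ≤-propagate (λ q → st π' j (base x) ≡ st π' q (base x)) j≤m
      (λ q j≤q q<m eq → trans eq
         (frame q (<⇒≤ q<m) (idle-run j≤q q<m) x is-out))
      refl

  runᵢ endᵢ stateᵢ : Fm (CVar X n)
  runᵢ   = runF i isInpᵢ
  endᵢ   = endF i isInpᵢ
  stateᵢ = stateF i isInpᵢ

  run-refuted : j ≤ p → p < m → Refuted p runᵢ
  run-refuted j≤p p<m = input-bv-refuted refl (<len (m<n⇒m<1+n p<m)) (idle-run j≤p p<m)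

  end-refuted : p ≤ m → Refuted p endᵢ
  end-refuted p≤m = output-bv-refuted refl (<len (m≤n⇒m≤1+n p≤m)) (end-false p≤m)

  state-refuted : j ≤ p → p < m → Refuted p stateᵢ
  state-refuted j≤p p<m =
    ∨-refuted (run-refuted j≤p p<m) (∧-refutedʳ (end-refuted (<⇒≤ p<m)))

  Y-end-refuted : p ≤ m → Refuted p (Yf endᵢ)
  Y-end-refuted {zero}  _   = refuted λ where
    minus ¬0<len → ¬0<len (nonempty π')
    plus  ()
  Y-end-refuted {suc p} p≤m = refuted λ where
    minus (inj₁ ¬p<len) → ¬p<len (<len (m≤n⇒m≤1+n p≤m))
    minus (inj₂ end-p)  → refutes (end-refuted (≤-trans (n≤1+n p) p≤m)) minus end-p
    plus  (_ , end-p)   → refutes (end-refuted (≤-trans (n≤1+n p) p≤m)) plus end-p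

  Rᵢ : Sgn → Fm X → Fm (CVar X n)
  Rᵢ = R i isInpᵢ

  RTᵢ : Sgn → Tm X → Tm (CVar X n)
  RTᵢ = RT i isInpᵢ

  j<len : j <L len π'
  j<len = <len (m≤n⇒m≤1+n j≤m)

  m<len : m <L len π'
  m<len = <len (n≤1+n m)

  mutual
    R-steady : ∀ s φ → AllVarsF IsVarᵢ φ → STF (kd i) φ → Steady j m (Rᵢ s φ)
    R-steady s (φ ∨f ψ) (vars-φ , vars-ψ) (st-∨ st-φ st-ψ) =
      ∨-steady (R-steady s φ vars-φ st-φ) (R-steady s ψ vars-ψ st-ψ)
    R-steady minus (¬f φ) vars (st-¬ st-φ) = ¬-steady (R-steady plus φ vars st-φ)
    R-steady plus  (¬f φ) vars (st-¬ st-φ) = ¬-steady (R-steady minus φ vars st-φ)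
    R-steady s ⊤f _ st-⊤ = steady (output-atom-steady {b = false} refl j<len m<len ⇔-refl)
    R-steady s ⊥f _ st-⊥ = steady (output-atom-steady {b = false} refl j<len m<len ⇔-refl)
    R-steady s (pr p as) vars (st-pr output-pred st-as)
      rewrite Equivalence.to T-not-≡ output-pred = steady (output-atom-steady
        (anyFin-false _ (λ a → RT-no-input S s (as a) (vars a)
                                 (anyFin-false⁻ _ (Equivalence.to T-not-≡ output-pred) a)))
        j<len m<len
        (args-steady (predM p) (λ a → RT-steady s (as a) (vars a) (st-as a))))
    R-steady s (bv x) _ (st-bv is-out) rewrite isOut⇒¬isInp is-out =
      steady (output-atom-steady (output-not-inputC is-out) j<len m<len
        ( subst (T ∘ bool) (outputs-frozen is-out)
        , subst (T ∘ bool) (sym (outputs-frozen is-out))))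
    R-steady minus (φ Uf ψ) _ (st-U _ _) = steady λ s' →
      U-steady s' (¬f stateᵢ ∨f Rᵢ minus φ) ((stateᵢ ∧f Rᵢ minus ψ) ∨f Yf endᵢ) j≤m
        (λ l j≤l l<m →
          inj₁ (¬-refuted (state-refuted j≤l l<m) s')
        , refutes (∨-refuted (∧-refutedˡ (state-refuted j≤l l<m)) (Y-end-refuted (<⇒≤ l<m))) s')
    R-steady plus (φ Uf ψ) _ (st-U _ _) = steady λ s' →
      U-steady s' (¬f stateᵢ ∨f Rᵢ plus φ) (stateᵢ ∧f Rᵢ plus ψ) j≤m (λ l j≤l l<m →
          inj₁ (¬-refuted (state-refuted j≤l l<m) s')
        , refutes (∧-refutedˡ (state-refuted j≤l l<m)) s')
    R-steady s (Yf φ) _ (st-Y _) = steady λ s' →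
      YS-steady s' (¬f runᵢ) (runᵢ ∧f Rᵢ s φ) j≤m m<len (λ l j≤l l<m →
          ¬-refuted (run-refuted j≤l l<m) s'
        , refutes (∧-refutedˡ (run-refuted j≤l l<m)) s')

    RT-steady : ∀ s u → AllVarsT IsVarᵢ u → STT (kd i) u → SteadyT j m (RTᵢ s u)
    RT-steady s (fn f as) vars (st-fn st-as) = steadyT λ v →
      args-steady (λ vs → v ≡ funM f vs) (λ a → RT-steady s (as a) (vars a) (st-as a))
    RT-steady s (var x) _ (st-var is-out) = steadyT λ v →
      (λ e → trans e (outputs-frozen is-out)) , (λ e → trans e (sym (outputs-frozen is-out)))
    RT-steady s (cst c) _ st-cst = steadyT λ _ → ⇔-refl
    RT-steady s (dfl u) _ st-dfl = steadyT λ _ → ⇔-refl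
    RT-steady s (ite φ u w) (vars-φ , vars-u , vars-w) (st-ite st-φ st-u st-w) =
      ite-steady (R-steady plus φ vars-φ st-φ) (RT-steady minus u vars-u st-u)
        (ite-steady (¬-steady (R-steady minus φ vars-φ st-φ)) (RT-steady minus w vars-w st-w)
                    (steadyT λ _ → ⇔-refl))
    RT-steady s (atP u φ) _ (st-atP _ _) =
      atP-steady j≤m (λ l j≤l l<m → ∧-refutedˡ (state-refuted j≤l l<m))

lemma5p10 : (S : Signature) (M : Structure S)
    (X : Set) (n : ℕ) (Ms : Fin n → ITS X (Structure.D M)) → Compatible Ms →
    (i : Fin n) (sgn : Sgn) (φ : Syntax.Fm S X) →
    Syntax.AllVarsF S (λ x → T (isVarK (ITS.kind (Ms i) x))) φ →
    Rewriting.STF S (ITS.kind (Ms i)) φ →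
    (π : Trace X (Structure.D M)) → IsTraceOf (Ms i) π →
    (π' : Trace (CVar X n) (Structure.D M)) →
    Composition.IsTraceC (Structure.bool M) Ms π' →
    Composition.Proj.ProjEq (Structure.bool M) Ms i π' π →
    (dflt : Syntax.Tm S (CVar X n) → Structure.D M) →
    (k : ℕ) → k <L len π →
    (m : ℕ) → Composition.Proj.IsMap (Structure.bool M) Ms i π' k m →
    (j : ℕ) → Composition.Proj.AfterPrev (Structure.bool M) Ms i π' k j → j < m →
    Semantics.Sat S M (Composition.isInpC (Structure.bool M) Ms) dflt π' sgn j
      (Rewriting.R S i (λ x → isInpK (ITS.kind (Ms i) x)) sgn φ)
    ⇔ Semantics.Sat S M (Composition.isInpC (Structure.bool M) Ms) dflt π' sgn m
      (Rewriting.R S i (λ x → isInpK (ITS.kind (Ms i) x)) sgn φ)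
lemma5p10 S M X n Ms _ i sgn φ vars stutter-tolerant _ _ π' tc _ dflt _ _ m is-map j after-prev j<m =
  steady-sat (R-steady sgn φ vars stutter-tolerant) sgn
  where
  open Counting (Structure.bool M) Ms i π'
  open Stuttering S M X n Ms i π' tc dflt j m j<m
         (runs-at-map is-map after-prev j<m) (λ p → idle-before-map is-map after-prev)
  open Steadiness S M (Composition.isInpC (Structure.bool M) Ms) dflt π' using (steady-sat)
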